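{- Let $p$ be a prime. Then $\omega_1(p^{p+1})=p^2$.
   Context: An integer polynomial $f$ is a null polynomial modulo $m$ if $f(x)\equiv 0\pmod m$ for every integer $x$; a monic null polynomial of degree $n$ modulo $m$ is one coefficientwise congruent modulo $m$ to a monic polynomial of degree $n$. $\omega_1(m)$ is the least integer $n\geq 1$ for which a monic null polynomial of degree $n$ modulo $m$ exists. -}

module Defs where

open import Data.Nat as ℕ using (ℕ; zero; suc)
open import Data.Integer as ℤ using (ℤ; +_; 0ℤ; 1ℤ)
open import Data.Integer.Divisibility using () renaming (_∣_ to _∣ℤ_)
open import Data.List using (List; []; _∷_; length)
open import Data.Product using (Σ; _×_; ∃-syntax)
open import Relation.Binary.PropositionalEquality using () renaming (_≡_ to _≡ₚ_)
open import Relation.Nullary using (¬_)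

-- An integer polynomial, as its list of coefficients in ascending order
-- of degree: a₀ ∷ a₁ ∷ … represents a₀ + a₁ x + a₂ x² + …
Poly : Set
Poly = List ℤ

eval : Poly → ℤ → ℤ
eval []       x = 0ℤ
eval (a ∷ as) x = a ℤ.+ x ℤ.* eval as x

coeff : Poly → ℕ → ℤ
coeff []       i       = 0ℤ
coeff (a ∷ as) zero    = a
coeff (a ∷ as) (suc i) = coeff as i

_≡_[mod_] : ℤ → ℤ → ℕ → Set
a ≡ b [mod m ] = (+ m) ∣ℤ (a ℤ.- b)

IsNullMod : ℕ → Poly → Set
IsNullMod m f = ∀ (x : ℤ) → eval f x ≡ 0ℤ [mod m ]

IsMonicOfDegree : ℕ → Poly → Set
IsMonicOfDegree n g = (length g ≡ₚ suc n)
                    × (coeff g n ≡ₚ 1ℤ)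

CoeffCongMod : ℕ → Poly → Poly → Set
CoeffCongMod m f g = ∀ (i : ℕ) → coeff f i ≡ coeff g i [mod m ]

IsMonicNullOfDegreeMod : ℕ → ℕ → Poly → Set
IsMonicNullOfDegreeMod m n f =
  IsNullMod m f × (∃[ g ] (IsMonicOfDegree n g × CoeffCongMod m f g))

HasMonicNull : ℕ → ℕ → Set
HasMonicNull m n = ∃[ f ] IsMonicNullOfDegreeMod m n f

Omega1Is : ℕ → ℕ → Set
Omega1Is m k =
  (1 ℕ.≤ k) × HasMonicNull m k
  × (∀ (n : ℕ) → 1 ℕ.≤ n → n ℕ.< k → ¬ HasMonicNull m n)

module Submission where

-- A monic null polynomial of degree n modulo m exists exactly when m ∣ n!: the n-th finite
-- difference of a monic polynomial of degree n is the constant n!, and conversely the falling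
-- factorial x (x - 1) ⋯ (x - n + 1) takes only values divisible by n!. So ω₁(m) is the least
-- n ≥ 1 with m ∣ n!. For m = p^(p+1): below p² every multiple of p is j p with j < p and
-- contributes a single factor p to n!, so p^(p+1) ∤ n! for n < p², whereas (p²)! is divisible
-- by p^p · p! and hence by p^(p+1).

open import Defs
open import Data.Nat using (ℕ; zero; suc; _!)
open import Data.Nat.Primality using (Prime)
open import Data.List using ([]; _∷_; length)
open import Data.Product using (_×_; _,_; ∃-syntax)
open import Data.Sum using (inj₁; inj₂)
open import Function using (_∘_)
open import Relation.Nullary using (¬_; yes; no)
open import Relation.Binary.PropositionalEquality

module _ where
  open import Data.Nat.Properties using (suc-injective)
  import Data.Nat.Divisibility as ℕ
  open import Data.Integer using (ℤ; +_; -[1+_]; 0ℤ; 1ℤ; _+_; _-_; _*_)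
  open import Data.Integer.Properties
    using (+-identityˡ; +-identityʳ; *-identityʳ; *-zeroʳ; +-inverseʳ; neg-involutive; pos-*)
  open import Data.Integer.Divisibility.Signed
    using (_∣_; divides; ∣-trans; ∣m∣n⇒∣m+n; ∣m∣n⇒∣m-n; ∣m+n∣m⇒∣n; ∣m+n∣n⇒∣m; ∣m⇒∣-m; ∣n⇒∣m*n; *-monoʳ-∣; ∣ᵤ⇒∣; ∣⇒∣ᵤ)
  open import Data.Integer.Tactic.RingSolver using (solve-∀)

  ∣m-n∣m⇒∣n : ∀ {d m n} → d ∣ m - n → d ∣ m → d ∣ n
  ∣m-n∣m⇒∣n {d} {n = n} d∣m-n d∣m =
    subst (d ∣_) (neg-involutive n) (∣m⇒∣-m (∣m+n∣m⇒∣n d∣m-n d∣m))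

  ∣m-n∣n⇒∣m : ∀ {d m n} → d ∣ m - n → d ∣ n → d ∣ m
  ∣m-n∣n⇒∣m d∣m-n d∣n = ∣m+n∣n⇒∣m d∣m-n (∣m⇒∣-m d∣n)

  ∣-by-steps : ∀ {d} (h : ℤ → ℤ) → d ∣ h 0ℤ → (∀ x → d ∣ h (1ℤ + x) - h x) → ∀ x → d ∣ h x
  ∣-by-steps {d} h base step (+ k) = upwards k
    where
      upwards : ∀ k → d ∣ h (+ k)
      upwards zero    = base
      upwards (suc k) = ∣m-n∣n⇒∣m (step (+ k)) (upwards k)
  ∣-by-steps {d} h base step -[1+ k ] = downwards k
    where
      downwards : ∀ k → d ∣ h -[1+ k ]
      downwards zero    = ∣m-n∣m⇒∣n (step -[1+ 0 ]) base
      downwards (suc k) = ∣m-n∣m⇒∣n (step -[1+ suc k ]) (downwards k)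

  Δ : ℕ → (ℤ → ℤ) → ℤ → ℤ
  Δ zero    h x = h x
  Δ (suc k) h x = Δ k h (1ℤ + x) - Δ k h x

  Δ-pres-∣ : ∀ {d} h → (∀ x → d ∣ h x) → ∀ k x → d ∣ Δ k h x
  Δ-pres-∣ h d∣h zero    x = d∣h x
  Δ-pres-∣ h d∣h (suc k) x = ∣m∣n⇒∣m-n (Δ-pres-∣ h d∣h k (1ℤ + x)) (Δ-pres-∣ h d∣h k x)

  Δ-+ : ∀ f g k x → Δ k (λ y → f y + g y) x ≡ Δ k f x + Δ k g x
  Δ-+ f g zero    x = refl
  Δ-+ f g (suc k) x = begin
      Δ k (λ y → f y + g y) (1ℤ + x) - Δ k (λ y → f y + g y) x
    ≡⟨ cong₂ _-_ (Δ-+ f g k (1ℤ + x)) (Δ-+ f g k x) ⟩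
      (Δ k f (1ℤ + x) + Δ k g (1ℤ + x)) - (Δ k f x + Δ k g x)
    ≡⟨ interchange (Δ k f (1ℤ + x)) (Δ k g (1ℤ + x)) (Δ k f x) (Δ k g x) ⟩
      Δ (suc k) f x + Δ (suc k) g x
    ∎
    where
      open ≡-Reasoning
      interchange : ∀ a b c d → (a + b) - (c + d) ≡ (a - c) + (b - d)
      interchange = solve-∀

  Δ-const : ∀ a k x → Δ (suc k) (λ _ → a) x ≡ 0ℤ
  Δ-const a zero    x = +-inverseʳ a
  Δ-const a (suc k) x = cong₂ _-_ (Δ-const a k (1ℤ + x)) (Δ-const a k x)

  Δ-id* : ∀ E k y → Δ (suc k) (λ x → x * E x) y ≡ y * Δ (suc k) E y + + suc k * Δ k E (1ℤ + y)
  Δ-id* E zero    y = base y (E (1ℤ + y)) (E y)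
    where
      base : ∀ y a b → (1ℤ + y) * a - y * b ≡ y * (a - b) + 1ℤ * a
      base = solve-∀
  Δ-id* E (suc k) y =
    trans (cong₂ _-_ (Δ-id* E k (1ℤ + y)) (Δ-id* E k y))
          (step y (+ suc k) (Δ k E (1ℤ + (1ℤ + y))) (Δ k E (1ℤ + y)) (Δ (suc k) E y))
    where
      step : ∀ y K C G Q → ((1ℤ + y) * (C - G) + K * C) - (y * Q + K * G)
                         ≡ y * ((C - G) - Q) + (1ℤ + K) * (C - G)
      step = solve-∀

  Δ-eval : ∀ d f → length f ≡ suc d → ∀ x → Δ d (eval f) x ≡ + (d !) * coeff f d
  Δ-eval zero    (a ∷ [])     refl x = constant a x
    where
      constant : ∀ a x → a + x * 0ℤ ≡ 1ℤ * a
      constant = solve-∀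
  Δ-eval (suc d) (a ∷ f) |f|≡d+1 x = begin
      Δ (suc d) (λ y → a + y * eval f y) x
    ≡⟨ Δ-+ (λ _ → a) (λ y → y * eval f y) (suc d) x ⟩
      Δ (suc d) (λ _ → a) x + Δ (suc d) (λ y → y * eval f y) x
    ≡⟨ cong₂ _+_ (Δ-const a d x) (Δ-id* (eval f) d x) ⟩
      0ℤ + (x * (Δ d (eval f) (1ℤ + x) - Δ d (eval f) x) + + suc d * Δ d (eval f) (1ℤ + x))
    ≡⟨ cong₂ (λ s t → 0ℤ + (x * (s - t) + + suc d * s)) (IH (1ℤ + x)) (IH x) ⟩
      0ℤ + (x * (K - K) + + suc d * K)
    ≡⟨ collapse x (+ suc d) (+ (d !)) (coeff f d) ⟩
      (+ suc d * + (d !)) * coeff f d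
    ≡⟨ cong (_* coeff f d) (pos-* (suc d) (d !)) ⟨
      + (suc d !) * coeff f d
    ∎
    where
      open ≡-Reasoning
      K : ℤ
      K = + (d !) * coeff f d
      IH : ∀ x → Δ d (eval f) x ≡ K
      IH = Δ-eval d f (suc-injective |f|≡d+1)
      collapse : ∀ x S F c → 0ℤ + (x * (F * c - F * c) + S * (F * c)) ≡ (S * F) * c
      collapse = solve-∀

  Δ-monic : ∀ n g → IsMonicOfDegree n g → ∀ x → Δ n (eval g) x ≡ + (n !)
  Δ-monic n g (|g|≡n+1 , lead≡1) x = begin
    Δ n (eval g) x          ≡⟨ Δ-eval n g |g|≡n+1 x ⟩
    + (n !) * coeff g n     ≡⟨ cong (+ (n !) *_) lead≡1 ⟩
    + (n !) * 1ℤ            ≡⟨ *-identityʳ (+ (n !)) ⟩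
    + (n !)                 ∎
    where open ≡-Reasoning

  horner-cong : ∀ {d} a b E F x → d ∣ a - b → d ∣ E - F → d ∣ (a + x * E) - (b + x * F)
  horner-cong a b E F x d∣a-b d∣E-F =
    subst (_ ∣_) (sym (regroup a b E F x)) (∣m∣n⇒∣m+n d∣a-b (∣n⇒∣m*n x d∣E-F))
    where
      regroup : ∀ a b E F x → (a + x * E) - (b + x * F) ≡ (a - b) + x * (E - F)
      regroup = solve-∀

  0+x*0≡0 : ∀ x → 0ℤ + x * 0ℤ ≡ 0ℤ
  0+x*0≡0 x = trans (+-identityˡ (x * 0ℤ)) (*-zeroʳ x)

  eval-cong : ∀ {d} f g → (∀ i → d ∣ coeff f i - coeff g i) → ∀ x → d ∣ eval f x - eval g x
  eval-cong []      []      _   x = divides 0ℤ refl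
  eval-cong (a ∷ f) []      f~g x = subst (λ t → _ ∣ (a + x * eval f x) - t) (0+x*0≡0 x)
    (horner-cong a 0ℤ (eval f x) 0ℤ x (f~g 0) (eval-cong f [] (f~g ∘ suc) x))
  eval-cong []      (b ∷ g) f~g x = subst (λ t → _ ∣ t - (b + x * eval g x)) (0+x*0≡0 x)
    (horner-cong 0ℤ b 0ℤ (eval g x) x (f~g 0) (eval-cong [] g (f~g ∘ suc) x))
  eval-cong (a ∷ f) (b ∷ g) f~g x =
    horner-cong a b (eval f x) (eval g x) x (f~g 0) (eval-cong f g (f~g ∘ suc) x)

  hasMonicNull⇒∣! : ∀ m n → HasMonicNull m n → m ℕ.∣ n !
  hasMonicNull⇒∣! m n (f , f-null , g , g-monic , f~g) =
    ∣⇒∣ᵤ (subst (+ m ∣_) (Δ-monic n g g-monic 0ℤ) (Δ-pres-∣ (eval g) g-null n 0ℤ))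
    where
      g-null : ∀ x → + m ∣ eval g x
      g-null x = ∣m-n∣m⇒∣n (eval-cong f g (∣ᵤ⇒∣ ∘ f~g) x)
                           (subst (+ m ∣_) (+-identityʳ (eval f x)) (∣ᵤ⇒∣ (f-null x)))

  _⊹[X-_]*_ : ℤ → ℤ → Poly → Poly
  c ⊹[X- a ]* []      = c ∷ []
  c ⊹[X- a ]* (b ∷ f) = (c - a * b) ∷ (b ⊹[X- a ]* f)

  eval-⊹[X-]* : ∀ c a f x → eval (c ⊹[X- a ]* f) x ≡ c + (x - a) * eval f x
  eval-⊹[X-]* c a []      x = x*0≡[x-a]*0 c x a
    where
      x*0≡[x-a]*0 : ∀ c x a → c + x * 0ℤ ≡ c + (x - a) * 0ℤ
      x*0≡[x-a]*0 = solve-∀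
  eval-⊹[X-]* c a (b ∷ f) x = begin
      (c - a * b) + x * eval (b ⊹[X- a ]* f) x
    ≡⟨ cong (λ t → (c - a * b) + x * t) (eval-⊹[X-]* b a f x) ⟩
      (c - a * b) + x * (b + (x - a) * eval f x)
    ≡⟨ expand c a b x (eval f x) ⟩
      c + (x - a) * (b + x * eval f x)
    ∎
    where
      open ≡-Reasoning
      expand : ∀ c a b x E → (c - a * b) + x * (b + (x - a) * E) ≡ c + (x - a) * (b + x * E)
      expand = solve-∀

  length-⊹[X-]* : ∀ c a f → length (c ⊹[X- a ]* f) ≡ suc (length f)
  length-⊹[X-]* c a []      = refl
  length-⊹[X-]* c a (b ∷ f) = cong suc (length-⊹[X-]* b a f)

  coeff-⊹[X-]*-top : ∀ c a f d → length f ≡ suc d → coeff (c ⊹[X- a ]* f) (suc d) ≡ coeff f d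
  coeff-⊹[X-]*-top c a (b ∷ [])    zero    refl    = refl
  coeff-⊹[X-]*-top c a (b ∷ f)     (suc d) |f|≡d+2 = coeff-⊹[X-]*-top b a f d (suc-injective |f|≡d+2)

  fallingFactorial : ℕ → ℤ → ℤ
  fallingFactorial zero    x = 1ℤ
  fallingFactorial (suc n) x = (x - + n) * fallingFactorial n x

  fallingFactorialPoly : ℕ → Poly
  fallingFactorialPoly zero    = 1ℤ ∷ []
  fallingFactorialPoly (suc n) = 0ℤ ⊹[X- + n ]* fallingFactorialPoly n

  eval-fallingFactorialPoly : ∀ n x → eval (fallingFactorialPoly n) x ≡ fallingFactorial n x
  eval-fallingFactorialPoly zero    x = trans (cong (λ t → 1ℤ + t) (*-zeroʳ x)) (+-identityʳ 1ℤ)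
  eval-fallingFactorialPoly (suc n) x = begin
    eval (0ℤ ⊹[X- + n ]* fallingFactorialPoly n) x       ≡⟨ eval-⊹[X-]* 0ℤ (+ n) (fallingFactorialPoly n) x ⟩
    0ℤ + (x - + n) * eval (fallingFactorialPoly n) x     ≡⟨ +-identityˡ _ ⟩
    (x - + n) * eval (fallingFactorialPoly n) x          ≡⟨ cong ((x - + n) *_) (eval-fallingFactorialPoly n x) ⟩
    (x - + n) * fallingFactorial n x                     ∎
    where open ≡-Reasoning

  fallingFactorialPoly-monic : ∀ n → IsMonicOfDegree n (fallingFactorialPoly n)
  fallingFactorialPoly-monic zero    = refl , refl
  fallingFactorialPoly-monic (suc n) with fallingFactorialPoly-monic n
  ... | |F|≡n+1 , lead≡1 =
    trans (length-⊹[X-]* 0ℤ (+ n) (fallingFactorialPoly n)) (cong suc |F|≡n+1) ,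
    trans (coeff-⊹[X-]*-top 0ℤ (+ n) (fallingFactorialPoly n) n |F|≡n+1) lead≡1

  fallingFactorial-0 : ∀ n → fallingFactorial (suc n) 0ℤ ≡ 0ℤ
  fallingFactorial-0 zero    = refl
  fallingFactorial-0 (suc n) =
    trans (cong ((0ℤ - + suc n) *_) (fallingFactorial-0 n)) (*-zeroʳ (0ℤ - + suc n))

  Δ-fallingFactorial : ∀ n x →
    fallingFactorial (suc n) (1ℤ + x) - fallingFactorial (suc n) x ≡ + suc n * fallingFactorial n x
  Δ-fallingFactorial zero    x = linear x
    where
      linear : ∀ x → ((1ℤ + x) - 0ℤ) * 1ℤ - (x - 0ℤ) * 1ℤ ≡ 1ℤ * 1ℤ
      linear = solve-∀
  Δ-fallingFactorial (suc n) x = begin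
      (1ℤ + x - + suc n) * F' - (x - + suc n) * ((x - + n) * F)
    ≡⟨ cong (λ t → (1ℤ + x - + suc n) * t - (x - + suc n) * ((x - + n) * F)) F'≡ ⟩
      (1ℤ + x - + suc n) * ((x - + n) * F + + suc n * F) - (x - + suc n) * ((x - + n) * F)
    ≡⟨ expand x (+ n) F ⟩
      + suc (suc n) * ((x - + n) * F)
    ∎
    where
      open ≡-Reasoning
      F F' : ℤ
      F  = fallingFactorial n x
      F' = fallingFactorial (suc n) (1ℤ + x)
      a≡b+[a-b] : ∀ a b → a ≡ b + (a - b)
      a≡b+[a-b] = solve-∀
      F'≡ : F' ≡ (x - + n) * F + + suc n * F
      F'≡ = trans (a≡b+[a-b] F' (fallingFactorial (suc n) x))
                  (cong (λ t → fallingFactorial (suc n) x + t) (Δ-fallingFactorial n x))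
      expand : ∀ x N F → (1ℤ + x - (1ℤ + N)) * ((x - N) * F + (1ℤ + N) * F) - (x - (1ℤ + N)) * ((x - N) * F)
                       ≡ (1ℤ + (1ℤ + N)) * ((x - N) * F)
      expand = solve-∀

  n!∣fallingFactorial : ∀ n x → + (n !) ∣ fallingFactorial n x
  n!∣fallingFactorial zero    x = divides 1ℤ refl
  n!∣fallingFactorial (suc n) = ∣-by-steps (fallingFactorial (suc n))
    (subst (+ (suc n !) ∣_) (sym (fallingFactorial-0 n)) (divides 0ℤ refl))
    step
    where
      step : ∀ x → + (suc n !) ∣ fallingFactorial (suc n) (1ℤ + x) - fallingFactorial (suc n) x
      step x = subst₂ _∣_ (sym (pos-* (suc n) (n !))) (sym (Δ-fallingFactorial n x))
                      (*-monoʳ-∣ (+ suc n) (n!∣fallingFactorial n x))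

  ∣!⇒hasMonicNull : ∀ m n → m ℕ.∣ n ! → HasMonicNull m n
  ∣!⇒hasMonicNull m n m∣n! = F , F-null , F , fallingFactorialPoly-monic n , F~F
    where
      F : Poly
      F = fallingFactorialPoly n
      F-null : IsNullMod m F
      F-null x = ∣⇒∣ᵤ (subst (+ m ∣_) (sym (trans (+-identityʳ (eval F x)) (eval-fallingFactorialPoly n x)))
                                (∣-trans (∣ᵤ⇒∣ m∣n!) (n!∣fallingFactorial n x)))
      F~F : CoeffCongMod m F F
      F~F i = ∣⇒∣ᵤ (subst (+ m ∣_) (sym (+-inverseʳ (coeff F i))) (divides 0ℤ refl))

open import Data.Nat
  using (_+_; _*_; _^_; _∸_; _≤_; _<_; z≤n; s≤s; NonZero; nonTrivial⇒≢1; >-nonZero⁻¹)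
open import Data.Nat.Properties
  using (<-trans; ≤-<-trans; n<1+n; <⇒≤; <⇒≱; m≤n⇒m≤1+n; m≤n+m; m+[n∸m]≡n; *-comm; *-suc
        ; *-monoˡ-≤; *-cancelʳ-<; ^-distribˡ-+-*; m^n≢0; m*n≢0)
open import Data.Nat.Divisibility
  using (_∣_; divides; _∣?_; ∣-refl; ∣-trans; 1∣_; ∣1⇒≡1; ∣⇒≤; m∣m*n; *-pres-∣; *-monoʳ-∣; *-cancelˡ-∣; m≤n⇒m!∣n!)
open import Data.Nat.Primality using (euclidsLemma; prime⇒nonZero; prime⇒nonTrivial)
open import Data.Nat.Tactic.RingSolver using (solve-∀)

prime∤1 : ∀ {p} → Prime p → ¬ p ∣ 1
prime∤1 pp p∣1 = nonTrivial⇒≢1 {{prime⇒nonTrivial pp}} (∣1⇒≡1 p∣1)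

m^n∣m^o : ∀ m {n o} → n ≤ o → m ^ n ∣ m ^ o
m^n∣m^o m {n} {o} n≤o = subst (m ^ n ∣_)
  (trans (sym (^-distribˡ-+-* m n (o ∸ n))) (cong (m ^_) (m+[n∸m]≡n n≤o)))
  (m∣m*n (m ^ (o ∸ n)))

-- Below p², each multiple j p of p (j < p) contributes exactly one factor p to n!.
factorial-below-p² : ∀ {p} → Prime p → ∀ n → n < p * p →
                     ∃[ e ] ∃[ u ] n ! ≡ p ^ e * u × ¬ p ∣ u × e * p ≤ n
factorial-below-p² pp zero    _ = 0 , 1 , refl , prime∤1 pp , z≤n
factorial-below-p² {p} pp (suc n) n+1<p² with factorial-below-p² pp n (<-trans (n<1+n n) n+1<p²) | p ∣? suc n
... | e , u , n!≡ , p∤u , ep≤n | no p∤n+1 =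
  e , suc n * u , [n+1]!≡ , p∤[n+1]u , m≤n⇒m≤1+n ep≤n
  where
    [n+1]!≡ : suc n * n ! ≡ p ^ e * (suc n * u)
    [n+1]!≡ = trans (cong (suc n *_) n!≡) (x*[y*z]≡y*[x*z] (suc n) (p ^ e) u)
      where
        x*[y*z]≡y*[x*z] : ∀ x y z → x * (y * z) ≡ y * (x * z)
        x*[y*z]≡y*[x*z] = solve-∀
    p∤[n+1]u : ¬ p ∣ suc n * u
    p∤[n+1]u p∣[n+1]u with euclidsLemma (suc n) u pp p∣[n+1]u
    ... | inj₁ p∣n+1 = p∤n+1 p∣n+1
    ... | inj₂ p∣u   = p∤u p∣u
... | e , u , n!≡ , p∤u , ep≤n | yes (divides (suc j) n+1≡[j+1]p) =
  suc e , suc j * u , [n+1]!≡ , p∤[j+1]u , [e+1]p≤n+1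
  where
    j+1<p : suc j < p
    j+1<p = *-cancelʳ-< p (suc j) p (subst (_< p * p) n+1≡[j+1]p n+1<p²)
    e<j+1 : e < suc j
    e<j+1 = *-cancelʳ-< p e (suc j) (≤-<-trans ep≤n (subst (n <_) n+1≡[j+1]p (n<1+n n)))
    [e+1]p≤n+1 : suc e * p ≤ suc n
    [e+1]p≤n+1 = subst (suc e * p ≤_) (sym n+1≡[j+1]p) (*-monoˡ-≤ p e<j+1)
    [n+1]!≡ : suc n * n ! ≡ p ^ suc e * (suc j * u)
    [n+1]!≡ = trans (cong₂ _*_ n+1≡[j+1]p n!≡) (regroup (suc j) p (p ^ e) u)
      where
        regroup : ∀ j p P u → (j * p) * (P * u) ≡ (p * P) * (j * u)
        regroup = solve-∀
    p∤[j+1]u : ¬ p ∣ suc j * u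
    p∤[j+1]u p∣[j+1]u with euclidsLemma (suc j) u pp p∣[j+1]u
    ... | inj₁ p∣j+1 = <⇒≱ j+1<p (∣⇒≤ p∣j+1)
    ... | inj₂ p∣u   = p∤u p∣u

p^[1+p]∤n! : ∀ {p} → Prime p → ∀ n → n < p * p → ¬ p ^ suc p ∣ n !
p^[1+p]∤n! {p} pp n n<p² p^[1+p]∣n! with factorial-below-p² pp n n<p²
... | e , u , n!≡ , p∤u , ep≤n = p∤u (*-cancelˡ-∣ (p ^ e) {{m^n≢0 p e {{prime⇒nonZero pp}}}} p^e*p∣p^e*u)
  where
    e<p : e < p
    e<p = *-cancelʳ-< p e p (≤-<-trans ep≤n n<p²)
    p^e*p∣p^e*u : p ^ e * p ∣ p ^ e * u
    p^e*p∣p^e*u = subst (_∣ p ^ e * u) (*-comm p (p ^ e))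
      (∣-trans (m^n∣m^o p (s≤s (<⇒≤ e<p))) (subst (p ^ suc p ∣_) n!≡ p^[1+p]∣n!))

p^k*k!∣[p*k]! : ∀ p k → .{{NonZero p}} → p ^ k * k ! ∣ (p * k) !
p^k*k!∣[p*k]! p       zero    = 1∣ _
p^k*k!∣[p*k]! (suc q) (suc k) = subst₂ _∣_ lhs rhs
    (*-pres-∣ (∣-trans (p^k*k!∣[p*k]! (suc q) k) (m≤n⇒m!∣n! (m≤n+m (suc q * k) q))) (∣-refl {suc r}))
  where
    r : ℕ
    r = q + suc q * k
    lhs : (suc q ^ k * k !) * suc r ≡ suc q ^ suc k * suc k !
    lhs = trans (cong ((suc q ^ k * k !) *_) (sym (*-suc (suc q) k))) (regroup (suc q ^ k) (k !) (suc q) k)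
      where
        regroup : ∀ P F p k → (P * F) * (p * (1 + k)) ≡ (p * P) * ((1 + k) * F)
        regroup = solve-∀
    rhs : r ! * suc r ≡ (suc q * suc k) !
    rhs = trans (*-comm (r !) (suc r)) (cong _! (sym (*-suc (suc q) k)))

p^[1+p]∣[p*p]! : ∀ p → .{{NonZero p}} → p ^ suc p ∣ (p * p) !
p^[1+p]∣[p*p]! p@(suc q) = ∣-trans p^[1+p]∣p^p*p! (p^k*k!∣[p*k]! p p)
  where
    p^[1+p]∣p^p*p! : p * p ^ p ∣ p ^ p * p !
    p^[1+p]∣p^p*p! = subst (_∣ p ^ p * p !) (*-comm (p ^ p) p) (*-monoʳ-∣ (p ^ p) (m∣m*n (q !)))

omega1-by-factorials : ∀ {m k} → 1 ≤ k → m ∣ k ! → (∀ n → n < k → ¬ m ∣ n !) → Omega1Is m k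
omega1-by-factorials 1≤k m∣k! m∤n! =
  1≤k , ∣!⇒hasMonicNull _ _ m∣k! , λ n _ n<k → m∤n! n n<k ∘ hasMonicNull⇒∣! _ n

mainTheorem16 : (p : ℕ) → Prime p → Omega1Is (p ^ suc p) (p * p)
mainTheorem16 p pp =
  omega1-by-factorials (>-nonZero⁻¹ (p * p) {{m*n≢0 p p}}) (p^[1+p]∣[p*p]! p) (p^[1+p]∤n! pp)
  where
    instance
      p≢0 : NonZero p
      p≢0 = prime⇒nonZero pp
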